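{- Each of the following families of sets is partition regular, meaning that if $C$ belongs to the family and $C = \bigcup_{i=1}^r C_i$ for some $r \in \mathbb{N}$, then $C_i$ belongs to the family for some $i \in \{1,\dots,r\}$: (a) for a countable abelian group $\Gamma$ and $k \in \mathbb{N}$, $\mathscr{C}_{k\text{ -sumset}} = \{A \subseteq \Gamma : \exists B \subseteq \Gamma \text{ infinite with } B^{\oplus k} \subseteq A\}$; (b) $\mathscr{C}_{\text{product}} = \bigcup_{k \ge 2} \mathscr{C}_{k\text{ -product set}}$, where $\mathscr{C}_{k\text{ -product set}} = \{A \subseteq \mathbb{N} : \exists B \subseteq \mathbb{N} \text{ infinite with } B^{\odot k} \subseteq A\}$; (c) for an integer-valued polynomial $P(x) \in \mathbb{Q}[x]$, $\mathscr{C}_P = \{A \subseteq \mathbb{N} : \exists B \subseteq \mathbb{N} \text{ infinite with } \{P(b_1)+b_2 : b_1,b_2 \in B,\ b_1<b_2\} \subseteq A\}$; (d) $\mathscr{C}_{\times,+} = \{A \subseteq \mathbb{N} : \exists B \subseteq \mathbb{N} \text{ infinite with } \{b_1b_2+b_3 : b_1,b_2,b_3 \in B,\ b_1<b_2<b_3\} \subseteq A\}$.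
   Context: $\mathbb{N} = \{1,2,3,\dots\}$. For $B \subseteq \Gamma$, $B^{\oplus k} = \{\sum_{x\in F} x : F \subseteq B,\ |F| = k\}$. For $B \subseteq \mathbb{N}$, $B^{\odot k} = \{\prod_{i=1}^k b_i : b_1,\dots,b_k \in B,\ b_1 < \dots < b_k\}$. A polynomial $P \in \mathbb{Q}[x]$ is integer-valued if $P(\mathbb{Z}) \subseteq \mathbb{Z}$. -}

module Defs where

open import Level using (0ℓ) renaming (suc to lsuc)
open import Data.Nat as ℕ using (ℕ; _<_; _≤_)
open import Data.Integer as ℤ using (ℤ; +_)
open import Data.Rational as ℚ using (ℚ)
open import Data.Fin using (Fin)
open import Data.List using (List; []; _∷_; length; foldr)
open import Data.List.Membership.Propositional using (_∈_)
open import Data.List.Relation.Unary.All using (All)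
open import Data.List.Relation.Unary.Linked using (Linked)
open import Data.List.Relation.Unary.Unique.Propositional using (Unique)
open import Data.Product using (Σ; ∃; _×_; _,_)
open import Relation.Nullary using (¬_)
open import Relation.Binary.PropositionalEquality using (_≡_)
open import Algebra.Bundles using (AbelianGroup)

Subset : Set → Set₁
Subset X = X → Set

_⊆_ : {X : Set} → Subset X → Subset X → Set
A ⊆ B = ∀ x → A x → B x

Finite : {X : Set} → Subset X → Set
Finite {X} B = Σ (List X) λ xs → ∀ x → B x → x ∈ xs

Infinite : {X : Set} → Subset X → Set
Infinite B = ¬ Finite B

Family : Set → Set₂
Family X = Subset X → Set₁

PartitionRegular : {X : Set} → Family X → Set₁
PartitionRegular {X} 𝓕 =
  (C : Subset X) → 𝓕 C →
  (r : ℕ) → 1 ≤ r → (Cs : Fin r → Subset X) →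
  (∀ i → Cs i ⊆ C) → (∀ x → C x → Σ (Fin r) λ i → Cs i x) →
  Σ (Fin r) λ i → 𝓕 (Cs i)

-- ℕ = {1,2,3,...}: subsets of ℕ are predicates on Agda's ℕ contained in
-- the positive naturals.
ℕ⁺ : Subset ℕ
ℕ⁺ n = 1 ≤ n

module _ (G : AbelianGroup 0ℓ 0ℓ) where
  open AbelianGroup G renaming (Carrier to Γ)

  gsum : List Γ → Γ
  gsum = foldr _∙_ ε

  SumsetIn : ℕ → Subset Γ → Subset Γ → Set
  SumsetIn k B A = (F : List Γ) → length F ≡ k → Unique F → All B F → A (gsum F)

  C-sumset : ℕ → Family Γ
  C-sumset k A = Σ (Subset Γ) λ B → Infinite B × SumsetIn k B A

  Countable : Set
  Countable = Σ (Γ → ℕ) λ f → ∀ x y → f x ≡ f y → x ≡ y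

nprod : List ℕ → ℕ
nprod = foldr ℕ._*_ 1

ProductsetIn : ℕ → Subset ℕ → Subset ℕ → Set
ProductsetIn k B A =
  (bs : List ℕ) → length bs ≡ k → Linked _<_ bs → All B bs → A (nprod bs)

C-kproduct : ℕ → Family ℕ
C-kproduct k A = A ⊆ ℕ⁺ × Σ (Subset ℕ) λ B → B ⊆ ℕ⁺ × Infinite B × ProductsetIn k B A

C-product : Family ℕ
C-product A = Σ ℕ λ k → 2 ≤ k × C-kproduct k A

-- A polynomial in ℚ[x] as its coefficient list [a₀, a₁, …, a_d].
Poly : Set
Poly = List ℚ

ℤtoℚ : ℤ → ℚ
ℤtoℚ z = z ℚ./ 1

ℕtoℚ : ℕ → ℚ
ℕtoℚ n = ℤtoℚ (+ n)

eval : Poly → ℚ → ℚ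
eval [] x = ℚ.0ℚ
eval (a ∷ as) x = a ℚ.+ x ℚ.* eval as x

IntegerValued : Poly → Set
IntegerValued P = ∀ (z : ℤ) → Σ ℤ λ m → eval P (ℤtoℚ z) ≡ ℤtoℚ m

-- {P(b₁)+b₂ : b₁,b₂ ∈ B, b₁<b₂} ⊆ A   (A ⊆ ℕ, so each value must be a
-- natural number lying in A).
C-P : Poly → Family ℕ
C-P P A = A ⊆ ℕ⁺ × Σ (Subset ℕ) λ B → B ⊆ ℕ⁺ × Infinite B ×
  (∀ b₁ b₂ → B b₁ → B b₂ → b₁ < b₂ →
     Σ ℕ λ n → (eval P (ℕtoℚ b₁) ℚ.+ ℕtoℚ b₂ ≡ ℕtoℚ n) × A n)

C-×+ : Family ℕ
C-×+ A = A ⊆ ℕ⁺ × Σ (Subset ℕ) λ B → B ⊆ ℕ⁺ × Infinite B ×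
  (∀ b₁ b₂ b₃ → B b₁ → B b₂ → B b₃ → b₁ < b₂ → b₂ < b₃ → A (b₁ ℕ.* b₂ ℕ.+ b₃))

{-# OPTIONS --safe #-}
-- Each family consists of the sets containing all values of a fixed function on the k-element
-- subsets of some infinite B.  Colour a k-element subset of B by a piece of the partition that
-- contains its value; the infinite Ramsey theorem gives an infinite monochromatic B′ ⊆ B, which
-- witnesses that this piece belongs to the family.  In (a) the group is first coded injectively
-- into ℕ, a k-element subset being represented by the increasing list of its codes.
module Submission where

open import Defs
open import Level using (0ℓ; lift; lower)
open import Data.Nat
  using (ℕ; zero; suc; _≤_; _<_; _+_; _*_; z≤n; s≤s; _≤?_; _≤′_; ≤′-refl; ≤′-step)
open import Data.Nat.Properties
  using (≤-trans; <-trans; <-irrefl; <-asym; <-cmp; ≰⇒>; <⇒≱; ≤∧≢⇒<; ≤⇒≤′; n<1+n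
        ; suc-injective; ≤-decTotalOrder)
open import Data.Fin using (Fin)
open import Data.Product using (Σ; _×_; _,_; proj₁; proj₂; map₂)
open import Data.List using (List; []; _∷_; length; map; concat; _++_; upTo; allFin)
open import Data.List.Properties using (length-map; map-injective)
open import Data.List.Extrema.Nat using (max; xs≤max)
open import Data.List.Membership.Propositional using (_∈_)
open import Data.List.Membership.Propositional.Properties
  using (∈-++⁺ˡ; ∈-++⁺ʳ; ∈-upTo⁺; ∈-map⁺; ∈-concat⁺′; ∈-allFin)
open import Data.List.Relation.Unary.Any using (here)
open import Data.List.Relation.Unary.All as All using (All; []; _∷_)
open import Data.List.Relation.Unary.All.Properties using (map⁺)
open import Data.List.Relation.Unary.AllPairs as AllPairs using (_∷_)
open import Data.List.Relation.Unary.Linked as Linked using (Linked; []; [-]; _∷_)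
open import Data.List.Relation.Unary.Linked.Properties as Linkedₚ
  using (Linked⇒AllPairs; AllPairs⇒Linked)
open import Data.List.Relation.Unary.Unique.Propositional using (Unique)
open import Data.List.Relation.Binary.Permutation.Propositional using (_↭_; ↭-sym; ↭⇒↭ₛ)
open import Data.List.Relation.Binary.Permutation.Propositional.Properties
  using (All-resp-↭; ↭-length)
import Data.List.Relation.Binary.Permutation.Homogeneous as Permutation
import Data.List.Relation.Binary.Permutation.Setoid.Properties as PermutationSetoid
import Data.List.Sort
open import Data.Rational as ℚ using (ℚ)
open import Data.Empty using (⊥-elim)
open import Data.Unit using (⊤; tt)
open import Function using (_∘_)
open import Relation.Nullary using (Dec; yes; no)
open import Relation.Nullary.Decidable using (map′; decidable-stable)
open import Relation.Binary.Definitions using (tri<; tri≈; tri>)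
import Relation.Binary.Construct.On as On
open import Algebra.Bundles using (AbelianGroup)
open import Axiom.ExcludedMiddle using (ExcludedMiddle)
open import Relation.Binary.PropositionalEquality
  using (_≡_; _≢_; refl; sym; trans; cong; subst; setoid; module ≡-Reasoning)

private
  variable
    X Y Z : Set
    A B C : Subset X
    r k : ℕ

infixr 21 _∩_

_∩_ : Subset X → Subset X → Subset X
(A ∩ B) x = A x × B x

⋃ : (Fin r → Subset X) → Subset X
⋃ {r = r} Cs x = Σ (Fin r) λ i → Cs i x

image : (X → Y) → Subset X → Subset Y
image f B y = Σ _ λ x → B x × f x ≡ y

Infinite-mono : A ⊆ B → Infinite A → Infinite B
Infinite-mono A⊆B A-inf (xs , B⊆xs) = A-inf (xs , λ x a → B⊆xs x (A⊆B x a))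

Infinite-image⁻ : (f : X → Y) → Infinite (image f B) → Infinite B
Infinite-image⁻ f fB-inf (xs , B⊆xs) =
  fB-inf (map f xs , λ { y (x , b , refl) → ∈-map⁺ f (B⊆xs x b) })

Finite⇒bounded : Finite B → Σ ℕ λ m → ∀ n → B n → n ≤ m
Finite⇒bounded (ns , B⊆ns) = max 0 ns , λ n b → All.lookup (xs≤max 0 ns) (B⊆ns n b)

unbounded⇒Infinite : (∀ m → Σ ℕ λ n → B n × m < n) → Infinite B
unbounded⇒Infinite unbounded B-fin with Finite⇒bounded B-fin
... | m , bound with unbounded m
... | n , b , m<n = <⇒≱ m<n (bound n b)

Infinite-above : Infinite B → ∀ m → Infinite (B ∩ (m <_))
Infinite-above {B = B} B-inf m (ns , above⊆ns) = B-inf (ns ++ upTo (suc m) , B⊆)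
  where
  B⊆ : ∀ n → B n → n ∈ ns ++ upTo (suc m)
  B⊆ n b with n ≤? m
  ... | yes n≤m = ∈-++⁺ʳ ns (∈-upTo⁺ (s≤s n≤m))
  ... | no n≰m  = ∈-++⁺ˡ (above⊆ns n (b , ≰⇒> n≰m))

All-image⇒map : {f : X → Y} {ys : List Y} →
                All (image f B) ys → Σ (List X) λ xs → map f xs ≡ ys × All B xs
All-image⇒map [] = [] , refl , []
All-image⇒map ((x , b , refl) ∷ fBs) with All-image⇒map fBs
... | xs , refl , Bs = x ∷ xs , refl , b ∷ Bs

Linked<⇒All> : ∀ {n ns} → Linked _<_ (n ∷ ns) → All (n <_) ns
Linked<⇒All> lk with Linked⇒AllPairs <-trans lk
... | n<ns ∷ _ = n<ns

All>⇒Linked< : ∀ {n ns} → All (n <_) ns → Linked _<_ ns → Linked _<_ (n ∷ ns)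
All>⇒Linked< []          []  = [-]
All>⇒Linked< (n<m ∷ _)   lk  = n<m ∷ lk

-- The k-element subsets of B are represented by the strictly increasing lists of length k.
AllTuples : ℕ → Subset ℕ → Subset (List ℕ) → Set
AllTuples k B Q = ∀ ns → length ns ≡ k → Linked _<_ ns → All B ns → Q ns

HomogeneousSubset : ℕ → Subset ℕ → Subset (List ℕ) → Set₁
HomogeneousSubset k B Q = Σ (Subset ℕ) λ H → H ⊆ B × Infinite H × AllTuples k H Q

Ramsey : ℕ → Set₁
Ramsey k = ∀ {r B} → Infinite B → (Cs : Fin r → Subset (List ℕ)) → AllTuples k B (⋃ Cs) →
           Σ (Fin r) λ i → HomogeneousSubset k B (Cs i)

PreservesCovers : (Subset X → Subset Y) → Set₁
PreservesCovers {X} Q =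
  ∀ {r} {C : Subset X} (Cs : Fin r → Subset X) → C ⊆ ⋃ Cs → Q C ⊆ ⋃ (Q ∘ Cs)

preimage-preservesCovers : (g : Y → X) → PreservesCovers (λ A → A ∘ g)
preimage-preservesCovers g Cs C⊆⋃ y = C⊆⋃ (g y)

relPreimage : (Y → X → Set) → Subset X → Subset Y
relPreimage R A y = Σ _ λ x → R y x × A x

relPreimage-preservesCovers : (R : Y → X → Set) → PreservesCovers (relPreimage R)
relPreimage-preservesCovers R Cs C⊆⋃ y (x , Ryx , c) with C⊆⋃ x c
... | i , cᵢ = i , x , Ryx , cᵢ

PreservesCovers-∘ : {Q₂ : Subset Y → Subset Z} {Q₁ : Subset X → Subset Y} →
                    PreservesCovers Q₂ → PreservesCovers Q₁ → PreservesCovers (Q₂ ∘ Q₁)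
PreservesCovers-∘ {Q₁ = Q₁} Q₂-covers Q₁-covers Cs C⊆⋃ = Q₂-covers (Q₁ ∘ Cs) (Q₁-covers Cs C⊆⋃)

PartitionRegular-transfer : {𝓕 𝓖 : Family X} → (∀ A → 𝓕 A → 𝓖 A) → (∀ A → 𝓖 A → 𝓕 A) →
                            PartitionRegular 𝓕 → PartitionRegular 𝓖
PartitionRegular-transfer 𝓕⇒𝓖 𝓖⇒𝓕 𝓕-regular C 𝓖C r r≥1 Cs Cs⊆C C⊆⋃ =
  map₂ (𝓕⇒𝓖 _) (𝓕-regular C (𝓖⇒𝓕 C 𝓖C) r r≥1 Cs Cs⊆C C⊆⋃)

PositiveFamily : (Subset ℕ → Subset ℕ → Set) → Family ℕ
PositiveFamily Witnesses A =
  A ⊆ ℕ⁺ × Σ (Subset ℕ) λ B → B ⊆ ℕ⁺ × Infinite B × Witnesses B A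

PositiveFamily-map : {W W′ : Subset ℕ → Subset ℕ → Set} →
                     (∀ {B A} → W B A → W′ B A) → ∀ A → PositiveFamily W A → PositiveFamily W′ A
PositiveFamily-map W⇒W′ A (A⁺ , B , B⁺ , B-inf , w) = A⁺ , B , B⁺ , B-inf , W⇒W′ w

TupleFamily : ℕ → (Subset ℕ → Subset (List ℕ)) → Family ℕ
TupleFamily k Q = PositiveFamily λ B A → AllTuples k B (Q A)

module _ {B : Subset ℕ} {Q : Subset (List ℕ)} where

  AllTuples-2⁺ : (∀ b₁ b₂ → B b₁ → B b₂ → b₁ < b₂ → Q (b₁ ∷ b₂ ∷ [])) → AllTuples 2 B Q
  AllTuples-2⁺ pairs (b₁ ∷ b₂ ∷ []) refl (b₁<b₂ ∷ [-]) (B₁ ∷ B₂ ∷ []) = pairs b₁ b₂ B₁ B₂ b₁<b₂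

  AllTuples-2⁻ : AllTuples 2 B Q → ∀ b₁ b₂ → B b₁ → B b₂ → b₁ < b₂ → Q (b₁ ∷ b₂ ∷ [])
  AllTuples-2⁻ tuples b₁ b₂ B₁ B₂ b₁<b₂ = tuples (b₁ ∷ b₂ ∷ []) refl (b₁<b₂ ∷ [-]) (B₁ ∷ B₂ ∷ [])

  AllTuples-3⁺ : (∀ b₁ b₂ b₃ → B b₁ → B b₂ → B b₃ → b₁ < b₂ → b₂ < b₃ → Q (b₁ ∷ b₂ ∷ b₃ ∷ [])) →
                 AllTuples 3 B Q
  AllTuples-3⁺ triples (b₁ ∷ b₂ ∷ b₃ ∷ []) refl (b₁<b₂ ∷ b₂<b₃ ∷ [-]) (B₁ ∷ B₂ ∷ B₃ ∷ []) =
    triples b₁ b₂ b₃ B₁ B₂ B₃ b₁<b₂ b₂<b₃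

  AllTuples-3⁻ : AllTuples 3 B Q →
                 ∀ b₁ b₂ b₃ → B b₁ → B b₂ → B b₃ → b₁ < b₂ → b₂ < b₃ → Q (b₁ ∷ b₂ ∷ b₃ ∷ [])
  AllTuples-3⁻ tuples b₁ b₂ b₃ B₁ B₂ B₃ b₁<b₂ b₂<b₃ =
    tuples (b₁ ∷ b₂ ∷ b₃ ∷ []) refl (b₁<b₂ ∷ b₂<b₃ ∷ [-]) (B₁ ∷ B₂ ∷ B₃ ∷ [])

-- Only the values on lists of the stated length matter; the others are junk.
polynomialShift : Poly → List ℕ → ℚ
polynomialShift P (b₁ ∷ b₂ ∷ _) = eval P (ℕtoℚ b₁) ℚ.+ ℕtoℚ b₂
polynomialShift P _             = ℚ.0ℚ

productShift : List ℕ → ℕ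
productShift (b₁ ∷ b₂ ∷ b₃ ∷ _) = b₁ * b₂ + b₃
productShift _                  = 0

increasing-codes⇒Unique : (code : X → ℕ) → ∀ {xs} → Linked _<_ (map code xs) → Unique xs
increasing-codes⇒Unique code lk =
  AllPairs.map (λ codex<codey x≡y → <-irrefl (cong code x≡y) codex<codey)
               (Linked⇒AllPairs <-trans (Linkedₚ.map⁻ lk))

module _ (code : X → ℕ) (code-injective : ∀ x y → code x ≡ code y → x ≡ y) where
  open Data.List.Sort (On.decTotalOrder ≤-decTotalOrder code) using (sort; sort-↭; sort-↗)
  open PermutationSetoid (setoid X) using (Unique-resp-↭)

  increasing-permutation : ∀ {xs} → Unique xs →
                           Σ (List X) λ ys → ys ↭ xs × Linked _<_ (map code ys)
  increasing-permutation {xs} xs-unique =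
    sort xs , sort-↭ xs ,
    Linkedₚ.map⁺ (AllPairs⇒Linked
      (AllPairs.zipWith strict (Linked⇒AllPairs ≤-trans (sort-↗ xs) , sorted-unique)))
    where
    sorted-unique : Unique (sort xs)
    sorted-unique = Unique-resp-↭ (↭⇒↭ₛ (↭-sym (sort-↭ xs))) xs-unique
    strict : ∀ {x y} → code x ≤ code y × x ≢ y → code x < code y
    strict (codex≤codey , x≢y) = ≤∧≢⇒< codex≤codey (x≢y ∘ code-injective _ _)

module _ (G : AbelianGroup 0ℓ 0ℓ) (≈⇒≡ : ∀ {x y} → AbelianGroup._≈_ G x y → x ≡ y) where
  open AbelianGroup G using (isCommutativeMonoid; reflexive) renaming (Carrier to Γ)

  gsum-↭ : ∀ {F F′ : List Γ} → F ↭ F′ → gsum G F ≡ gsum G F′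
  gsum-↭ F↭F′ = ≈⇒≡ (PermutationSetoid.foldr-commMonoid (AbelianGroup.setoid G) isCommutativeMonoid
                       (Permutation.map reflexive (↭⇒↭ₛ F↭F′)))

module Classical (em : ExcludedMiddle (Level.suc 0ℓ)) where

  decide : (P : Set) → Dec P
  decide P = map′ lower lift em

  Infinite⇒inhabited : Infinite B → Σ _ B
  Infinite⇒inhabited {B = B} B-inf =
    decidable-stable (decide (Σ _ B)) λ empty → B-inf ([] , λ x b → ⊥-elim (empty (x , b)))

  Infinite-pigeonhole : {Ds : Fin r → Subset X} →
                        Infinite B → B ⊆ ⋃ Ds → Σ (Fin r) λ i → Infinite (B ∩ Ds i)
  Infinite-pigeonhole {r = r} {B = B} {Ds} B-inf B⊆⋃
    with decide (Σ (Fin r) λ i → Infinite (B ∩ Ds i))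
  ... | yes found = found
  ... | no none = ⊥-elim (B-inf (concat (map (proj₁ ∘ piece-finite) (allFin r)) , B⊆pieces))
    where
    piece-finite : ∀ i → Finite (B ∩ Ds i)
    piece-finite i = decidable-stable (decide _) λ piece-inf → none (i , piece-inf)
    B⊆pieces : ∀ x → B x → x ∈ concat (map (proj₁ ∘ piece-finite) (allFin r))
    B⊆pieces x b with B⊆⋃ x b
    ... | i , d = ∈-concat⁺′ (proj₂ (piece-finite i) x (b , d)) (∈-map⁺ _ (∈-allFin i))

  Infinite-image : (f : X → Y) → (∀ x y → f x ≡ f y → x ≡ y) →
                   Infinite B → Infinite (image f B)
  Infinite-image {B = B} f f-injective B-inf (ys , fB⊆ys) =
    B-inf (concat (map (λ y → preimage (decide (image f B y))) ys) , B⊆preimages)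
    where
    preimage : ∀ {y} → Dec (image f B y) → List _
    preimage (yes (x , _)) = x ∷ []
    preimage (no _)        = []
    preimage-complete : ∀ x → B x → (d : Dec (image f B (f x))) → x ∈ preimage d
    preimage-complete x b (yes (x′ , _ , fx′≡fx)) = here (f-injective x x′ (sym fx′≡fx))
    preimage-complete x b (no ∉image)             = ⊥-elim (∉image (x , b , refl))
    B⊆preimages : ∀ x → B x → x ∈ concat (map (λ y → preimage (decide (image f B y))) ys)
    B⊆preimages x b =
      ∈-concat⁺′ (preimage-complete x b _) (∈-map⁺ _ (fB⊆ys (f x) (x , b , refl)))

  -- Repeatedly pick a pivot and pass, by Ramsey for k, to an infinite set above it on which the
  -- colour of pivot ∷ ns does not depend on ns; the pivots of one colour (pigeonhole) are then
  -- homogeneous for k + 1.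
  module RamseyStep {k} (ramsey-k : Ramsey k) {r} {B : Subset ℕ} (B-inf : Infinite B)
                    (Cs : Fin r → Subset (List ℕ)) (cover : AllTuples (suc k) B (⋃ Cs)) where

    record Stage : Set₁ where
      field
        D     : Subset ℕ
        D-inf : Infinite D
        D⊆B   : D ⊆ B

    record Split (S : Stage) : Set₁ where
      field
        pivot        : ℕ
        pivot∈D      : Stage.D S pivot
        colour       : Fin r
        next         : Stage
        next-above   : Stage.D next ⊆ Stage.D S ∩ (pivot <_)
        next-tuples  : AllTuples k (Stage.D next) (Cs colour ∘ (pivot ∷_))

    split : (S : Stage) → Split S
    split S with Infinite⇒inhabited (Stage.D-inf S)
    ... | x , x∈D
      with ramsey-k (Infinite-above (Stage.D-inf S) x) (λ i → Cs i ∘ (x ∷_)) cover-above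
      where
      open Stage S
      cover-above : AllTuples k (D ∩ (x <_)) (⋃ λ i → Cs i ∘ (x ∷_))
      cover-above ns refl lk above =
        cover (x ∷ ns) refl (All>⇒Linked< (All.map proj₂ above) lk)
              (D⊆B x x∈D ∷ All.map (λ {n} → D⊆B n ∘ proj₁) above)
    ... | c , H , H⊆ , H-inf , H-tuples = record
      { pivot = x ; pivot∈D = x∈D ; colour = c
      ; next = record { D = H ; D-inf = H-inf ; D⊆B = λ n h → Stage.D⊆B S n (proj₁ (H⊆ n h)) }
      ; next-above = H⊆ ; next-tuples = H-tuples }

    stage : ℕ → Stage
    stage zero    = record { D = B ; D-inf = B-inf ; D⊆B = λ _ b → b }
    stage (suc n) = Split.next (split (stage n))

    module _ (n : ℕ) where
      open Split (split (stage n)) public using (pivot; pivot∈D; colour; next-above; next-tuples)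

    D : ℕ → Subset ℕ
    D n = Stage.D (stage n)

    D-antitone : ∀ {m n} → m ≤′ n → D n ⊆ D m
    D-antitone ≤′-refl          x d = d
    D-antitone (≤′-step {n} m≤′n) x d = D-antitone m≤′n x (proj₁ (next-above n x d))

    pivot-in-later : ∀ {m n} → m < n → D (suc m) (pivot n)
    pivot-in-later {n = n} m<n = D-antitone (≤⇒≤′ m<n) (pivot n) (pivot∈D n)

    pivot-strictMono : ∀ {m n} → m < n → pivot m < pivot n
    pivot-strictMono {m} {n} m<n = proj₂ (next-above m (pivot n) (pivot-in-later m<n))

    pivot-index : ∀ {m n} → pivot m < pivot n → m < n
    pivot-index {m} {n} p with <-cmp m n
    ... | tri< m<n _ _ = m<n
    ... | tri≈ _ refl _ = ⊥-elim (<-irrefl refl p)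
    ... | tri> _ _ n<m = ⊥-elim (<-asym p (pivot-strictMono n<m))

    pivot-grows : ∀ n → n ≤ pivot n
    pivot-grows zero    = z≤n
    pivot-grows (suc n) = ≤-trans (s≤s (pivot-grows n)) (pivot-strictMono (n<1+n n))

    Pivots : Subset ℕ
    Pivots = image pivot λ _ → ⊤

    Pivots-inf : Infinite Pivots
    Pivots-inf = unbounded⇒Infinite λ m → pivot (suc m) , (suc m , tt , refl) , pivot-grows (suc m)

    PivotsOfColour : Fin r → Subset ℕ
    PivotsOfColour i = image pivot λ n → colour n ≡ i

    Pivots⊆⋃ : Pivots ⊆ ⋃ PivotsOfColour
    Pivots⊆⋃ _ (n , _ , refl) = colour n , n , refl , refl

    PivotsOfColour-tuples : ∀ i → AllTuples (suc k) (PivotsOfColour i) (Cs i)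
    PivotsOfColour-tuples i (_ ∷ ns) len lk ((n , refl , refl) ∷ ns-pivots) =
      next-tuples n ns (suc-injective len) (Linked.tail lk)
        (All.zipWith (λ (x-pivot , n<x) → later-pivot-in-next x-pivot n<x)
                     (ns-pivots , Linked<⇒All> lk))
      where
      later-pivot-in-next : ∀ {P x} → image pivot P x → pivot n < x → D (suc n) x
      later-pivot-in-next (m , _ , refl) n<m = pivot-in-later (pivot-index {n} {m} n<m)

    homogeneous : Σ (Fin r) λ i → HomogeneousSubset (suc k) B (Cs i)
    homogeneous with Infinite-pigeonhole Pivots-inf Pivots⊆⋃
    ... | i , inf =
      i , PivotsOfColour i , PivotsOfColour⊆B , Infinite-mono (λ _ → proj₂) inf ,
      PivotsOfColour-tuples i
      where
      PivotsOfColour⊆B : PivotsOfColour i ⊆ B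
      PivotsOfColour⊆B _ (n , _ , refl) = Stage.D⊆B (stage n) _ (pivot∈D n)

  ramsey : ∀ k → Ramsey k
  ramsey zero B-inf Cs cover with cover [] refl [] []
  ... | i , c = i , _ , (λ _ b → b) , B-inf , λ { [] refl _ _ → c }
  ramsey (suc k) B-inf Cs cover = RamseyStep.homogeneous (ramsey k) B-inf Cs cover

  ramsey-refine : {Q : Subset X → Subset (List ℕ)} {Cs : Fin r → Subset X} →
                  PreservesCovers Q → ∀ k {B} → Infinite B → AllTuples k B (Q C) → C ⊆ ⋃ Cs →
                  Σ (Fin r) λ i → HomogeneousSubset k B (Q (Cs i))
  ramsey-refine {Q = Q} {Cs} Q-covers k B-inf B-tuples C⊆⋃ =
    ramsey k B-inf (Q ∘ Cs) λ ns len lk Bs → Q-covers Cs C⊆⋃ ns (B-tuples ns len lk Bs)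

  TupleFamily-partitionRegular : {Q : Subset ℕ → Subset (List ℕ)} →
                                 PreservesCovers Q → ∀ k → PartitionRegular (TupleFamily k Q)
  TupleFamily-partitionRegular Q-covers k C (C⁺ , B , B⁺ , B-inf , B-tuples) r _ Cs Cs⊆C C⊆⋃
    with ramsey-refine Q-covers k B-inf B-tuples C⊆⋃
  ... | i , H , H⊆B , H-inf , H-tuples =
    i , (λ x c → C⁺ x (Cs⊆C i x c)) , H , (λ x h → B⁺ x (H⊆B x h)) , H-inf , H-tuples

  -- C-kproduct k is definitionally TupleFamily k (λ A → A ∘ nprod).
  C-kproduct-partitionRegular : ∀ k → PartitionRegular (C-kproduct k)
  C-kproduct-partitionRegular = TupleFamily-partitionRegular (preimage-preservesCovers nprod)

  C-product-partitionRegular : PartitionRegular C-product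
  C-product-partitionRegular C (k , 2≤k , C-k) r r≥1 Cs Cs⊆C C⊆⋃ =
    map₂ (λ Cs-k → k , 2≤k , Cs-k) (C-kproduct-partitionRegular k C C-k r r≥1 Cs Cs⊆C C⊆⋃)

  C-P-partitionRegular : ∀ P → PartitionRegular (C-P P)
  C-P-partitionRegular P =
    PartitionRegular-transfer (PositiveFamily-map AllTuples-2⁻) (PositiveFamily-map AllTuples-2⁺)
      (TupleFamily-partitionRegular (relPreimage-preservesCovers R) 2)
    where
    R : List ℕ → ℕ → Set
    R ns n = polynomialShift P ns ≡ ℕtoℚ n

  C-×+-partitionRegular : PartitionRegular C-×+
  C-×+-partitionRegular =
    PartitionRegular-transfer (PositiveFamily-map AllTuples-3⁻) (PositiveFamily-map AllTuples-3⁺)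
      (TupleFamily-partitionRegular (preimage-preservesCovers productShift) 3)

  module Sumsets (G : AbelianGroup 0ℓ 0ℓ) (≈⇒≡ : ∀ {x y} → AbelianGroup._≈_ G x y → x ≡ y)
                 (code : AbelianGroup.Carrier G → ℕ)
                 (code-injective : ∀ x y → code x ≡ code y → x ≡ y) where
    open AbelianGroup G using () renaming (Carrier to Γ)

    Codes : List ℕ → List Γ → Set
    Codes ns F = map code F ≡ ns

    SumIn : Subset Γ → Subset (List ℕ)
    SumIn = relPreimage Codes ∘ (λ A → A ∘ gsum G)

    SumIn-preservesCovers : PreservesCovers SumIn
    SumIn-preservesCovers =
      PreservesCovers-∘ (relPreimage-preservesCovers Codes) (preimage-preservesCovers (gsum G))

    SumsetIn⇒AllTuples : SumsetIn G k B A → AllTuples k (image code B) (SumIn A)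
    SumsetIn⇒AllTuples B-sums ns len lk codes with All-image⇒map codes
    ... | F , refl , Bs =
      F , refl , B-sums F (trans (sym (length-map code F)) len) (increasing-codes⇒Unique code lk) Bs

    AllTuples⇒SumsetIn : {H : Subset ℕ} → AllTuples k H (SumIn A) → SumsetIn G k (H ∘ code) A
    AllTuples⇒SumsetIn {k} {A} H-tuples F len F-unique Hs
      with increasing-permutation code code-injective F-unique
    ... | S , S↭F , S-increasing
      with H-tuples (map code S) (trans (length-map code S) (trans (↭-length S↭F) len))
                    S-increasing (map⁺ (All-resp-↭ (↭-sym S↭F) Hs))
    ... | F′ , codes≡ , A-sum = subst A F′-sum A-sum
      where
      open ≡-Reasoning
      F′-sum : gsum G F′ ≡ gsum G F
      F′-sum = begin
        gsum G F′ ≡⟨ cong (gsum G) (map-injective (code-injective _ _) codes≡) ⟩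
        gsum G S  ≡⟨ gsum-↭ G ≈⇒≡ S↭F ⟩
        gsum G F  ∎

    partitionRegular : ∀ k → PartitionRegular (C-sumset G k)
    partitionRegular k C (B , B-inf , B-sums) r _ Cs Cs⊆C C⊆⋃
      with ramsey-refine {Q = SumIn} SumIn-preservesCovers k
                         (Infinite-image code code-injective B-inf)
                         (SumsetIn⇒AllTuples {A = C} B-sums) C⊆⋃
    ... | i , H , H⊆codes , H-inf , H-tuples =
      i , H ∘ code , Infinite-image⁻ code (Infinite-mono H⊆image H-inf) ,
      AllTuples⇒SumsetIn {A = Cs i} H-tuples
      where
      H⊆image : H ⊆ image code (H ∘ code)
      H⊆image n h with H⊆codes n h
      ... | x , _ , refl = x , h , refl

proposition1p8 : ExcludedMiddle (Level.suc 0ℓ) →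
    ((G : AbelianGroup 0ℓ 0ℓ) →
      (∀ {x y} → AbelianGroup._≈_ G x y → x ≡ y) →
      Countable G →
      (k : ℕ) → 1 ≤ k → PartitionRegular (C-sumset G k))
    × PartitionRegular C-product
    × ((P : Poly) → IntegerValued P → PartitionRegular (C-P P))
    × PartitionRegular C-×+
proposition1p8 em =
  (λ G ≈⇒≡ (code , code-injective) k _ → Sumsets.partitionRegular G ≈⇒≡ code code-injective k) ,
  C-product-partitionRegular ,
  (λ P _ → C-P-partitionRegular P) ,
  C-×+-partitionRegular
  where open Classical em
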